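{- Let $n\geq1$, let $\tau$ be a triangular norm without zero divisors (equivalently, without nilpotent elements), and let $\mathbb{X}_1=\langle X_1;\mu_{X_1}\rangle,\dots,\mathbb{X}_n=\langle X_n;\mu_{X_n}\rangle$ be distributive (respectively, modular) fuzzy lattices. Then $\langle\prod_{i=1}^n X_i;\mu_p\rangle$, where $\mu_p((x_1,\dots,x_n),(y_1,\dots,y_n))=\tau^{(n)}(\mu_{X_1}(x_1,y_1),\dots,\mu_{X_n}(x_n,y_n))$, is a distributive (respectively, modular) fuzzy lattice.
   Context: A fuzzy relation on a set $X$ is a map $\mu\colon X\times X\to[0,1]$; it is reflexive if $\mu(x,x)=1$; transitive if $\mu(x,y)>0$ and $\mu(y,z)>0$ imply $\mu(x,z)>0$; anti-symmetric if $\mu(x,y)>0$ and $\mu(y,x)>0$ imply $x=y$. A fuzzy poset is $\langle X;\mu\rangle$ with $\mu$ reflexive, transitive, anti-symmetric. For $Y\subseteq X$: $x$ is a fuzzy lower (upper) bound of $Y$ if $\mu(x,y)>0$ (resp. $\mu(y,x)>0$) for all $y\in Y$; a fuzzy lower bound $x_0$ of $Y$ is its fuzzy meet if $\mu(x,x_0)>0$ for every fuzzy lower bound $x$; a fuzzy upper bound $x_0$ is its fuzzy join if $\mu(x_0,x)>0$ for every fuzzy upper bound $x$. Write $x\odot y$, $x\oplus y$ for the fuzzy meet and join of $\{x,y\}$. A fuzzy lattice is a fuzzy poset in which all $x\odot y$, $x\oplus y$ exist. It is distributive if $x\odot(y\oplus z)=(x\odot y)\oplus(x\odot z)$ and $x\oplus(y\odot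 z)=(x\oplus y)\odot(x\oplus z)$ for all $x,y,z$; it is modular if $(x\odot y)\oplus(z\odot y)=((x\odot y)\oplus z)\odot y$ for all $x,y,z$. A triangular norm is a map $\tau\colon[0,1]^2\to[0,1]$ that is associative, commutative, monotone in each argument and satisfies $\tau(a,1)=a$; it has zero divisors if $\tau(a,b)=0$ for some $a,b\in(0,1)$. Its $n$-ary extension: $\tau^{(1)}(a_1)=a_1$, $\tau^{(n)}(a_1,\dots,a_n)=\tau(\tau^{(n-1)}(a_1,\dots,a_{n-1}),a_n)$; $a\in(0,1)$ is nilpotent if $\tau^{(m)}(a,\dots,a)=0$ for some positive integer $m$. -}

module Defs where

open import Data.Nat using (ℕ; zero; suc)
open import Data.Fin using (Fin; zero; suc)
open import Data.Vec using (Vec; []; _∷_)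
open import Data.Product using (Σ; _×_; _,_)
open import Data.Unit using (⊤; tt)
open import Function using (_∘_)
open import Relation.Nullary using (¬_)
open import Relation.Binary.PropositionalEquality using (_≡_; _≢_)
open import Relation.Binary.Structures using (IsTotalOrder)

record UnitInterval : Set₁ where
  field
    I            : Set
    _≤_          : I → I → Set
    isTotalOrder : IsTotalOrder _≡_ _≤_
    𝟘 𝟙          : I
    𝟘-min        : ∀ a → 𝟘 ≤ a
    𝟙-max        : ∀ a → a ≤ 𝟙
    𝟘≢𝟙          : 𝟘 ≢ 𝟙

  _<_ : I → I → Set
  a < b = (a ≤ b) × (a ≢ b)

module _ (U : UnitInterval) where
  open UnitInterval U

  record TNorm : Set where
    field
      τ      : I → I → I
      assoc  : ∀ a b c → τ (τ a b) c ≡ τ a (τ b c)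
      comm   : ∀ a b → τ a b ≡ τ b a
      monoˡ  : ∀ {a b} c → a ≤ b → τ a c ≤ τ b c
      monoʳ  : ∀ {a b} c → a ≤ b → τ c a ≤ τ c b
      identʳ : ∀ a → τ a 𝟙 ≡ a

    τfold : ∀ {k} → I → Vec I k → I
    τfold acc []      = acc
    τfold acc (b ∷ v) = τfold (τ acc b) v

    τⁿ : ∀ {m} → Vec I (suc m) → I
    τⁿ (a ∷ v) = τfold a v

  NoZeroDivisors : TNorm → Set
  NoZeroDivisors T = ∀ a b → 𝟘 < a → a < 𝟙 → 𝟘 < b → b < 𝟙 → TNorm.τ T a b ≢ 𝟘

  module _ {X : Set} (μ : X → X → I) where

    Pos : X → X → Set
    Pos x y = 𝟘 < μ x y

    record IsFuzzyPoset : Set where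
      field
        refl    : ∀ x → μ x x ≡ 𝟙
        trans   : ∀ {x y z} → Pos x y → Pos y z → Pos x z
        antisym : ∀ {x y} → Pos x y → Pos y x → x ≡ y

    IsFuzzyMeet : X → X → X → Set
    IsFuzzyMeet x y m =
      Pos m x × Pos m y × (∀ z → Pos z x → Pos z y → Pos z m)

    IsFuzzyJoin : X → X → X → Set
    IsFuzzyJoin x y m =
      Pos x m × Pos y m × (∀ z → Pos x z → Pos y z → Pos m z)

    record IsFuzzyLattice : Set where
      field
        isFuzzyPoset : IsFuzzyPoset
        _⊙_          : X → X → X
        _⊕_          : X → X → X
        ⊙-meet       : ∀ x y → IsFuzzyMeet x y (x ⊙ y)
        ⊕-join       : ∀ x y → IsFuzzyJoin x y (x ⊕ y)

    IsDistributiveFuzzyLattice : Set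
    IsDistributiveFuzzyLattice = Σ IsFuzzyLattice λ L →
      let open IsFuzzyLattice L in
      (∀ x y z → x ⊙ (y ⊕ z) ≡ (x ⊙ y) ⊕ (x ⊙ z)) ×
      (∀ x y z → x ⊕ (y ⊙ z) ≡ (x ⊕ y) ⊙ (x ⊕ z))

    IsModularFuzzyLattice : Set
    IsModularFuzzyLattice = Σ IsFuzzyLattice λ L →
      let open IsFuzzyLattice L in
      ∀ x y z → (x ⊙ y) ⊕ (z ⊙ y) ≡ ((x ⊙ y) ⊕ z) ⊙ y

  Prod : (n : ℕ) → (Fin n → Set) → Set
  Prod zero    X = ⊤
  Prod (suc n) X = X zero × Prod n (X ∘ suc)

  μVec : (n : ℕ) (X : Fin n → Set) (μ : (i : Fin n) → X i → X i → I) →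
         Prod n X → Prod n X → Vec I n
  μVec zero    X μ _        _        = []
  μVec (suc n) X μ (x , xs) (y , ys) =
    μ zero x y ∷ μVec n (X ∘ suc) (μ ∘ suc) xs ys

  μProd : TNorm → (m : ℕ) (X : Fin (suc m) → Set)
          (μ : (i : Fin (suc m)) → X i → X i → I) →
          Prod (suc m) X → Prod (suc m) X → I
  μProd T m X μ x y = TNorm.τⁿ T (μVec (suc m) X μ x y)

-- Without zero divisors, τ(a, b) > 0 exactly when a > 0 and b > 0, so μ_p(x, y) > 0
-- exactly when μ_i(x_i, y_i) > 0 for every i. The support of μ_p is therefore the
-- product of the supports of the μ_i, and the support of a fuzzy lattice is an
-- ordinary lattice order with the same meet and join. A product of lattice orders is
-- a lattice order under the componentwise operations, which satisfy every identity
-- that holds in all factors, in particular the distributive and modular laws.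
module Submission where

open import Defs
open import Algebra.Core using (Op₂)
open import Algebra.Definitions using (_DistributesOverˡ_)
open import Data.Fin using (Fin; zero; suc)
open import Data.Nat using (ℕ; zero; suc)
open import Data.Product using (_×_; _,_; proj₁; proj₂; zip′)
open import Data.Product.Relation.Binary.Pointwise.NonDependent using (Pointwise)
open import Data.Unit using (⊤; tt)
open import Data.Vec using (Vec; []; _∷_)
open import Data.Vec.Relation.Unary.All using (All; []; _∷_)
open import Function using (_∘_)
open import Function.Bundles using (_⇔_; mk⇔; Equivalence)
open import Function.Construct.Composition using (_⇔-∘_)
open import Level using (0ℓ)
open import Relation.Binary.Core using (Rel)
open import Relation.Binary.Definitions using (Reflexive)
open import Relation.Binary.Lattice using (IsLattice)
open import Relation.Binary.Structures using (IsTotalOrder)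
open import Relation.Binary.PropositionalEquality as ≡
  using (_≡_; _≢_; refl; sym; cong₂; subst)

ModularLaw : {A : Set} → Op₂ A → Op₂ A → Set
ModularLaw _∧_ _∨_ = ∀ x y z → ((x ∧ y) ∨ (z ∧ y)) ≡ (((x ∧ y) ∨ z) ∧ y)

⊤-isLattice : IsLattice _≡_ (λ (_ _ : ⊤) → ⊤) (λ _ _ → tt) (λ _ _ → tt)
⊤-isLattice = record
  { isPartialOrder = record
    { isPreorder = record
      { isEquivalence = ≡.isEquivalence
      ; reflexive     = λ _ → tt
      ; trans         = λ _ _ → tt
      }
    ; antisym = λ _ _ → refl
    }
  ; supremum = λ _ _ → tt , tt , λ _ _ _ → tt
  ; infimum  = λ _ _ → tt , tt , λ _ _ _ → tt
  }

module _ {A B : Set} {_≤₁_ : Rel A 0ℓ} {_≤₂_ : Rel B 0ℓ}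
         {_∨₁_ _∧₁_ : Op₂ A} {_∨₂_ _∧₂_ : Op₂ B} where

  ×-isLattice : IsLattice _≡_ _≤₁_ _∨₁_ _∧₁_ → IsLattice _≡_ _≤₂_ _∨₂_ _∧₂_ →
                IsLattice _≡_ (Pointwise _≤₁_ _≤₂_) (zip′ _∨₁_ _∨₂_) (zip′ _∧₁_ _∧₂_)
  ×-isLattice L₁ L₂ = record
    { isPartialOrder = record
      { isPreorder = record
        { isEquivalence = ≡.isEquivalence
        ; reflexive     = λ { refl → L₁.refl , L₂.refl }
        ; trans         = λ (p₁ , p₂) (q₁ , q₂) → L₁.trans p₁ q₁ , L₂.trans p₂ q₂
        }
      ; antisym = λ (p₁ , p₂) (q₁ , q₂) → cong₂ _,_ (L₁.antisym p₁ q₁) (L₂.antisym p₂ q₂)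
      }
    ; supremum = λ (x₁ , x₂) (y₁ , y₂) →
        (L₁.x≤x∨y x₁ y₁ , L₂.x≤x∨y x₂ y₂) , (L₁.y≤x∨y x₁ y₁ , L₂.y≤x∨y x₂ y₂) ,
        λ (z₁ , z₂) (p₁ , p₂) (q₁ , q₂) → L₁.∨-least p₁ q₁ , L₂.∨-least p₂ q₂
    ; infimum = λ (x₁ , x₂) (y₁ , y₂) →
        (L₁.x∧y≤x x₁ y₁ , L₂.x∧y≤x x₂ y₂) , (L₁.x∧y≤y x₁ y₁ , L₂.x∧y≤y x₂ y₂) ,
        λ (z₁ , z₂) (p₁ , p₂) (q₁ , q₂) → L₁.∧-greatest p₁ q₁ , L₂.∧-greatest p₂ q₂
    }
    where
    module L₁ = IsLattice L₁
    module L₂ = IsLattice L₂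

module _ (U : UnitInterval) where
  open UnitInterval U

  Pointwise∏ : ∀ n {X : Fin n → Set} → ((i : Fin n) → Rel (X i) 0ℓ) → Rel (Prod U n X) 0ℓ
  Pointwise∏ zero    R = λ _ _ → ⊤
  Pointwise∏ (suc n) R = Pointwise (R zero) (Pointwise∏ n (R ∘ suc))

  zipWith∏ : ∀ n {X : Fin n → Set} → ((i : Fin n) → Op₂ (X i)) → Op₂ (Prod U n X)
  zipWith∏ zero    f = λ _ _ → tt
  zipWith∏ (suc n) f = zip′ (f zero) (zipWith∏ n (f ∘ suc))

  Pointwise∏-refl : ∀ n {X : Fin n → Set} {R : (i : Fin n) → Rel (X i) 0ℓ} →
                    ((i : Fin n) → Reflexive (R i)) → Reflexive (Pointwise∏ n R)
  Pointwise∏-refl zero    r = tt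
  Pointwise∏-refl (suc n) r = r zero , Pointwise∏-refl n (r ∘ suc)

  ∏-isLattice : ∀ n {X : Fin n → Set} {R : (i : Fin n) → Rel (X i) 0ℓ}
                {∨ ∧ : (i : Fin n) → Op₂ (X i)} →
                ((i : Fin n) → IsLattice _≡_ (R i) (∨ i) (∧ i)) →
                IsLattice _≡_ (Pointwise∏ n R) (zipWith∏ n ∨) (zipWith∏ n ∧)
  ∏-isLattice zero    L = ⊤-isLattice
  ∏-isLattice (suc n) L = ×-isLattice (L zero) (∏-isLattice n (L ∘ suc))

  ∏-distribˡ : ∀ n {X : Fin n → Set} {* + : (i : Fin n) → Op₂ (X i)} →
               ((i : Fin n) → _DistributesOverˡ_ _≡_ (* i) (+ i)) →
               _DistributesOverˡ_ _≡_ (zipWith∏ n *) (zipWith∏ n +)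
  ∏-distribˡ zero    D _        _        _        = refl
  ∏-distribˡ (suc n) D (x , xs) (y , ys) (z , zs) =
    cong₂ _,_ (D zero x y z) (∏-distribˡ n (D ∘ suc) xs ys zs)

  ∏-modular : ∀ n {X : Fin n → Set} {∧ ∨ : (i : Fin n) → Op₂ (X i)} →
              ((i : Fin n) → ModularLaw (∧ i) (∨ i)) →
              ModularLaw (zipWith∏ n ∧) (zipWith∏ n ∨)
  ∏-modular zero    M _        _        _        = refl
  ∏-modular (suc n) M (x , xs) (y , ys) (z , zs) =
    cong₂ _,_ (M zero x y z) (∏-modular n (M ∘ suc) xs ys zs)

  All-μVec⇔ : ∀ n {X : Fin n → Set} {μ : (i : Fin n) → X i → X i → I} {P : I → Set} xs ys →
              All P (μVec U n X μ xs ys) ⇔ Pointwise∏ n (λ i x y → P (μ i x y)) xs ys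
  All-μVec⇔ zero    _        _        = mk⇔ (λ _ → tt) (λ _ → [])
  All-μVec⇔ (suc n) (x , xs) (y , ys) =
    mk⇔ (λ { (p ∷ ps) → p , Equivalence.to   tail ps })
        (λ { (p , ps) → p ∷ Equivalence.from tail ps })
    where tail = All-μVec⇔ n xs ys

  𝟘<𝟙 : 𝟘 < 𝟙
  𝟘<𝟙 = 𝟘-min 𝟙 , 𝟘≢𝟙

  positive-mono : ∀ {a b} → 𝟘 < a → a ≤ b → 𝟘 < b
  positive-mono {a} {b} (_ , 𝟘≢a) a≤b = 𝟘-min b , λ 𝟘≡b →
    𝟘≢a (IsTotalOrder.antisym isTotalOrder (𝟘-min a) (subst (a ≤_) (sym 𝟘≡b) a≤b))

  module _ {X : Set} {μ : X → X → I} where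

    isFuzzyLattice⇒isLattice : (L : IsFuzzyLattice U μ) →
                               let open IsFuzzyLattice L in IsLattice _≡_ (Pos U μ) _⊕_ _⊙_
    isFuzzyLattice⇒isLattice L = record
      { isPartialOrder = record
        { isPreorder = record
          { isEquivalence = ≡.isEquivalence
          ; reflexive     = λ { {x} refl → subst (𝟘 <_) (sym (IsFuzzyPoset.refl P x)) 𝟘<𝟙 }
          ; trans         = IsFuzzyPoset.trans P
          }
        ; antisym = IsFuzzyPoset.antisym P
        }
      ; supremum = IsFuzzyLattice.⊕-join L
      ; infimum  = IsFuzzyLattice.⊙-meet L
      }
      where P = IsFuzzyLattice.isFuzzyPoset L

    isLattice⇒isFuzzyLattice : {_≼_ : Rel X 0ℓ} {∨ ∧ : Op₂ X} →
                               (∀ x → μ x x ≡ 𝟙) → (∀ {x y} → Pos U μ x y ⇔ (x ≼ y)) →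
                               IsLattice _≡_ _≼_ ∨ ∧ → IsFuzzyLattice U μ
    isLattice⇒isFuzzyLattice {_≼_} {∨} {∧} μ-refl supp L = record
      { isFuzzyPoset = record
        { refl    = μ-refl
        ; trans   = λ p q → from (L.trans (to p) (to q))
        ; antisym = λ p q → L.antisym (to p) (to q)
        }
      ; _⊙_    = ∧
      ; _⊕_    = ∨
      ; ⊙-meet = λ x y → from (L.x∧y≤x x y) , from (L.x∧y≤y x y) ,
                         λ z p q → from (L.∧-greatest (to p) (to q))
      ; ⊕-join = λ x y → from (L.x≤x∨y x y) , from (L.y≤x∨y x y) ,
                         λ z p q → from (L.∨-least (to p) (to q))
      }
      where
      module L = IsLattice L
      to : ∀ {x y} → Pos U μ x y → x ≼ y
      to = Equivalence.to supp
      from : ∀ {x y} → x ≼ y → Pos U μ x y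
      from = Equivalence.from supp

  module _ (T : TNorm U) where
    open TNorm T

    τ-≤ˡ : ∀ a b → τ a b ≤ a
    τ-≤ˡ a b = subst (τ a b ≤_) (identʳ a) (monoʳ a (𝟙-max b))

    τ-positive⁻ : ∀ {a b} → 𝟘 < τ a b → 𝟘 < a × 𝟘 < b
    τ-positive⁻ {a} {b} p =
      positive-mono p (τ-≤ˡ a b) , positive-mono p (subst (_≤ b) (comm b a) (τ-≤ˡ b a))

    τfold-identity : ∀ {k} a {v : Vec I k} → All (_≡ 𝟙) v → τfold a v ≡ a
    τfold-identity a []                 = refl
    τfold-identity a {b ∷ _} (b≡𝟙 ∷ v≡𝟙) =
      ≡.trans (τfold-identity (τ a b) v≡𝟙) (≡.trans (≡.cong (τ a) b≡𝟙) (identʳ a))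

    τⁿ-𝟙 : ∀ {m} {v : Vec I (suc m)} → All (_≡ 𝟙) v → τⁿ v ≡ 𝟙
    τⁿ-𝟙 {v = a ∷ _} (a≡𝟙 ∷ v≡𝟙) = ≡.trans (τfold-identity a v≡𝟙) a≡𝟙

    τfold-positive⁻ : ∀ {k} a (v : Vec I k) → 𝟘 < τfold a v → 𝟘 < a × All (𝟘 <_) v
    τfold-positive⁻ a []      p = p , []
    τfold-positive⁻ a (b ∷ v) p with τfold-positive⁻ (τ a b) v p
    ... | ab>𝟘 , v>𝟘 with τ-positive⁻ ab>𝟘
    ...   | a>𝟘 , b>𝟘 = a>𝟘 , b>𝟘 ∷ v>𝟘

    μProd-refl : ∀ m {X : Fin (suc m) → Set} {μ : (i : Fin (suc m)) → X i → X i → I} →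
                 ((i : Fin (suc m)) → ∀ x → μ i x x ≡ 𝟙) → ∀ xs → μProd U T m X μ xs xs ≡ 𝟙
    μProd-refl m {X} {μ} μ-refl xs =
      τⁿ-𝟙 (Equivalence.from (All-μVec⇔ (suc m) {X} {μ} xs xs) diagonal)
      where
      diagonal : Pointwise∏ (suc m) (λ i x y → μ i x y ≡ 𝟙) xs xs
      diagonal = Pointwise∏-refl (suc m) {R = λ i x y → μ i x y ≡ 𝟙} (λ i {x} → μ-refl i x)

    module _ (noZeroDivisors : NoZeroDivisors U T) where

      -- Equality on I is not decidable, so instead of splitting on a ≡ 𝟙 we refute it
      -- under the assumption 𝟘 ≡ τ a b, where it would give 𝟘 ≡ τ 𝟙 b ≡ b (dually for b).
      τ-positive : ∀ {a b} → 𝟘 < a → 𝟘 < b → 𝟘 < τ a b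
      τ-positive {a} {b} (_ , 𝟘≢a) (_ , 𝟘≢b) = 𝟘-min (τ a b) , λ 𝟘≡τab →
        noZeroDivisors a b (𝟘-min a , 𝟘≢a) (𝟙-max a , a≢𝟙 𝟘≡τab)
                           (𝟘-min b , 𝟘≢b) (𝟙-max b , b≢𝟙 𝟘≡τab) (sym 𝟘≡τab)
        where
        a≢𝟙 : 𝟘 ≡ τ a b → a ≢ 𝟙
        a≢𝟙 e a≡𝟙 = 𝟘≢b (≡.trans e (≡.trans (≡.cong (λ t → τ t b) a≡𝟙)
                                            (≡.trans (comm 𝟙 b) (identʳ b))))
        b≢𝟙 : 𝟘 ≡ τ a b → b ≢ 𝟙
        b≢𝟙 e b≡𝟙 = 𝟘≢a (≡.trans e (≡.trans (≡.cong (τ a) b≡𝟙) (identʳ a)))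

      τfold-positive : ∀ {k} {a} {v : Vec I k} → 𝟘 < a → All (𝟘 <_) v → 𝟘 < τfold a v
      τfold-positive a>𝟘 []          = a>𝟘
      τfold-positive a>𝟘 (b>𝟘 ∷ v>𝟘) = τfold-positive (τ-positive a>𝟘 b>𝟘) v>𝟘

      τⁿ-positive⇔ : ∀ {m} (v : Vec I (suc m)) → 𝟘 < τⁿ v ⇔ All (𝟘 <_) v
      τⁿ-positive⇔ (a ∷ v) =
        mk⇔ (λ p → let a>𝟘 , v>𝟘 = τfold-positive⁻ a v p in a>𝟘 ∷ v>𝟘)
            (λ { (a>𝟘 ∷ v>𝟘) → τfold-positive a>𝟘 v>𝟘 })

      μProd-positive⇔ : ∀ m {X : Fin (suc m) → Set} {μ : (i : Fin (suc m)) → X i → X i → I} →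
                        ∀ {xs ys} → Pos U (μProd U T m X μ) xs ys ⇔
                                    Pointwise∏ (suc m) (λ i → Pos U (μ i)) xs ys
      μProd-positive⇔ m {X} {μ} {xs} {ys} = All-μVec⇔ (suc m) {X} {μ} xs ys ⇔-∘ τⁿ-positive⇔ _

      ∏-isFuzzyLattice : ∀ m {X : Fin (suc m) → Set} {μ : (i : Fin (suc m)) → X i → X i → I} →
                         (L : (i : Fin (suc m)) → IsFuzzyLattice U (μ i)) →
                         IsFuzzyLattice U (μProd U T m X μ)
      ∏-isFuzzyLattice m {X} {μ} L = isLattice⇒isFuzzyLattice
        (μProd-refl m {X} {μ} (IsFuzzyPoset.refl ∘ IsFuzzyLattice.isFuzzyPoset ∘ L))
        (μProd-positive⇔ m {X} {μ})
        (∏-isLattice (suc m) (isFuzzyLattice⇒isLattice ∘ L))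

theorem5p6 : (U : UnitInterval) (T : TNorm U) → NoZeroDivisors U T →
    (m : ℕ) (X : Fin (suc m) → Set)
    (μ : (i : Fin (suc m)) → X i → X i → UnitInterval.I U) →
    (((i : Fin (suc m)) → IsDistributiveFuzzyLattice U (μ i)) →
      IsDistributiveFuzzyLattice U (μProd U T m X μ)) ×
    (((i : Fin (suc m)) → IsModularFuzzyLattice U (μ i)) →
      IsModularFuzzyLattice U (μProd U T m X μ))
theorem5p6 U T noZeroDivisors m X μ = distributive , modular
  where
  open IsFuzzyLattice

  distributive : ((i : Fin (suc m)) → IsDistributiveFuzzyLattice U (μ i)) →
                 IsDistributiveFuzzyLattice U (μProd U T m X μ)
  distributive D =
    ∏-isFuzzyLattice U T noZeroDivisors m L ,
    ∏-distribˡ U (suc m) {* = _⊙_ ∘ L} {+ = _⊕_ ∘ L} (proj₁ ∘ proj₂ ∘ D) ,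
    ∏-distribˡ U (suc m) {* = _⊕_ ∘ L} {+ = _⊙_ ∘ L} (proj₂ ∘ proj₂ ∘ D)
    where L = proj₁ ∘ D

  modular : ((i : Fin (suc m)) → IsModularFuzzyLattice U (μ i)) →
            IsModularFuzzyLattice U (μProd U T m X μ)
  modular M =
    ∏-isFuzzyLattice U T noZeroDivisors m L ,
    ∏-modular U (suc m) {∧ = _⊙_ ∘ L} {∨ = _⊕_ ∘ L} (proj₂ ∘ M)
    where L = proj₁ ∘ M
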